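{- Let $X_n=\sum_{\nu\vdash n}z_\nu-n!$. Then \[X_n=n!\left(\frac{2}{n^2}+o(n^{ -2})\right)=(2+o(1))\frac{n!}{n^2}\quad\text{as } n\to\infty.\]
   Context: The sum is over all integer partitions $\nu$ of $n$; for $\nu$ with $m_j(\nu)$ parts equal to $j$, $z_\nu=\prod_j j^{m_j(\nu)}m_j(\nu)!$. -}

module Defs where

open import Data.Nat using (ℕ; zero; suc; _+_; _*_; _∸_; _^_; _≤ᵇ_; _≟_; _!)
open import Data.Nat.Properties using ()
open import Data.Bool using (if_then_else_)
open import Data.List using (List; []; _∷_; _++_; map; concatMap; replicate; upTo; filter; length)
open import Data.Nat.ListAction using (sum; product)
open import Data.Integer using (+_)
open import Data.Rational using (ℚ; _/_; _-_)

-- Integer partitions of n, represented as lists of positive parts in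
-- nonincreasing order.  `partitionsLe n k` enumerates (each exactly once)
-- the partitions of n all of whose parts are ≤ k: choose the number m of
-- parts equal to k (0 ≤ m, m*k ≤ n), then a partition of n ∸ m*k with parts ≤ k-1.
partitionsLe : ℕ → ℕ → List (List ℕ)
partitionsLe zero    zero    = [] ∷ []
partitionsLe (suc _) zero    = []
partitionsLe n       (suc k) =
  concatMap
    (λ m → if m * suc k ≤ᵇ n
             then map (replicate m (suc k) ++_) (partitionsLe (n ∸ m * suc k) k)
             else [])
    (upTo (suc n))

partitions : ℕ → List (List ℕ)
partitions n = partitionsLe n n

mult : ℕ → List ℕ → ℕ
mult j ν = length (filter (j ≟_) ν)

-- z_ν = ∏_j j^{m_j(ν)} m_j(ν)!   (product over j = 1 .. |ν|; factors with
-- m_j(ν) = 0 equal 1, and every part of ν is ≤ |ν| = sum ν)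
z : List ℕ → ℕ
z ν = product (map (λ j → (j ^ mult j ν) * (mult j ν) !) (map suc (upTo (sum ν))))

ℕtoℚ : ℕ → ℚ
ℕtoℚ k = (+ k) / 1

X : ℕ → ℚ
X n = ℕtoℚ (sum (map z (partitions n))) - ℕtoℚ (n !)

{-# OPTIONS --safe #-}
-- Let Z(n,k) (zSum n k) be the sum of z_ν over the partitions ν ⊢ n with all parts
-- ≤ k.  Since z is multiplicative over blocks of distinct part sizes, splitting off the
-- m parts equal to k gives Z(n,k) = ∑_m k^m m! Z(n − mk, k − 1), with Z(n,1) = n!.
-- By strong induction Z(n,k) ≤ 2 n!, so raising k to c = k + 1 adds at most 2 Φ(c,n),
-- where Φ(c,n) = ∑_{m≥1} c^m m! (n − mc)! ≤ 6c (n − c)!; raising k from 1 to 2 adds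
-- exactly Φ(2,n) = 2 (n−2)! + O(n (n−4)!).  Hence Z(n,n) = n! + 2 (n−2)! + O((n−3)!),
-- that is, X_n n² = 2 n! + O(n!/n).
module Submission where

module PartitionSums where

  open import Defs
  open import Data.Nat
  open import Data.Nat.Properties
  open import Data.Nat.Induction using (<-rec)
  open import Data.Nat.ListAction using (sum; product)
  open import Data.Nat.ListAction.Properties using (sum-++; product-++)
  open import Data.Nat.Tactic.RingSolver using (solve-∀)
  open import Data.Bool using (true; false; if_then_else_; T)
  open import Data.Empty using (⊥-elim)
  open import Data.Unit using (tt)
  open import Data.List using (List; []; _∷_; _++_; map; concatMap; replicate; upTo; applyUpTo; filter; length)
  open import Data.List.Properties
    using (map-++; length-++; length-replicate; filter-++; filter-all; filter-none; map-cong; map-∘; map-upTo; applyUpTo-∷ʳ)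
  open import Data.List.Relation.Unary.All as All using (All; []; _∷_)
  open import Data.List.Relation.Unary.All.Properties using (++⁺; concat⁺; replicate⁺) renaming (map⁺ to All-map⁺)
  open import Algebra.Properties.CommutativeSemigroup *-commutativeSemigroup using (x∙yz≈y∙xz)
  open import Function using (_∘_; _∘′_)
  open import Relation.Binary.PropositionalEquality
  open import Relation.Nullary using (yes; no)

  ∑ : ℕ → (ℕ → ℕ) → ℕ
  ∑ N f = sum (applyUpTo f N)

  ∑-cong : ∀ {f g} N → (∀ i → f i ≡ g i) → ∑ N f ≡ ∑ N g
  ∑-cong zero    f≗g = refl
  ∑-cong (suc N) f≗g = cong₂ _+_ (f≗g 0) (∑-cong N (f≗g ∘ suc))

  ∑-mono-≤ : ∀ {f g} N → (∀ i → f i ≤ g i) → ∑ N f ≤ ∑ N g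
  ∑-mono-≤ zero    f≤g = z≤n
  ∑-mono-≤ (suc N) f≤g = +-mono-≤ (f≤g 0) (∑-mono-≤ N (f≤g ∘ suc))

  ∑-zero : ∀ {f} N → (∀ i → i < N → f i ≡ 0) → ∑ N f ≡ 0
  ∑-zero zero    f≡0 = refl
  ∑-zero (suc N) f≡0 = cong₂ _+_ (f≡0 0 z<s) (∑-zero N (λ i i<N → f≡0 (suc i) (s<s i<N)))

  ∑-*ˡ : ∀ a f N → ∑ N (λ i → a * f i) ≡ a * ∑ N f
  ∑-*ˡ a f zero    = sym (*-zeroʳ a)
  ∑-*ˡ a f (suc N) = trans (cong (a * f 0 +_) (∑-*ˡ a (f ∘ suc) N)) (sym (*-distribˡ-+ a (f 0) _))

  ∑-snoc : ∀ f N → ∑ (suc N) f ≡ ∑ N f + f N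
  ∑-snoc f N = begin
    sum (applyUpTo f (suc N))              ≡⟨ cong sum (applyUpTo-∷ʳ f N) ⟨
    sum (applyUpTo f N ++ f N ∷ [])        ≡⟨ sum-++ (applyUpTo f N) _ ⟩
    sum (applyUpTo f N) + (f N + 0)        ≡⟨ cong (∑ N f +_) (+-identityʳ (f N)) ⟩
    ∑ N f + f N                            ∎
    where open ≡-Reasoning

  mult-++ : ∀ j xs ys → mult j (xs ++ ys) ≡ mult j xs + mult j ys
  mult-++ j xs ys = trans (cong length (filter-++ (j ≟_) xs ys)) (length-++ (filter (j ≟_) xs))

  mult-replicate : ∀ j m → mult j (replicate m j) ≡ m
  mult-replicate j m = trans (cong length (filter-all (j ≟_) (replicate⁺ m refl))) (length-replicate m)

  mult-replicate-≢ : ∀ {j c} m → j ≢ c → mult j (replicate m c) ≡ 0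
  mult-replicate-≢ m j≢c = cong length (filter-none (_ ≟_) (replicate⁺ m j≢c))

  mult-all< : ∀ {j xs} → All (_< j) xs → mult j xs ≡ 0
  mult-all< xs<j = cong length (filter-none (_ ≟_) (All.map (λ x<j j≡x → <-irrefl (sym j≡x) x<j) xs<j))

  partWeight : ℕ → ℕ → ℕ
  partWeight j m = j ^ m * m !

  zUpTo : ℕ → List ℕ → ℕ
  zUpTo zero    ν = 1
  zUpTo (suc B) ν = zUpTo B ν * partWeight (suc B) (mult (suc B) ν)

  z≡zUpTo-sum : ∀ ν → z ν ≡ zUpTo (sum ν) ν
  z≡zUpTo-sum ν = trans (cong product (trans (sym (map-∘ (upTo (sum ν)))) (map-upTo _ (sum ν)))) (product≡zUpTo (sum ν))
    where
    weight : ℕ → ℕ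
    weight i = partWeight (suc i) (mult (suc i) ν)
    product≡zUpTo : ∀ B → product (applyUpTo weight B) ≡ zUpTo B ν
    product≡zUpTo zero    = refl
    product≡zUpTo (suc B) = begin
      product (applyUpTo weight (suc B))              ≡⟨ cong product (applyUpTo-∷ʳ weight B) ⟨
      product (applyUpTo weight B ++ weight B ∷ [])   ≡⟨ product-++ (applyUpTo weight B) _ ⟩
      product (applyUpTo weight B) * (weight B * 1)   ≡⟨ cong₂ _*_ (product≡zUpTo B) (*-identityʳ (weight B)) ⟩
      zUpTo B ν * weight B                            ∎
      where open ≡-Reasoning

  zUpTo-cong : ∀ B {ν μ} → (∀ j → j ≤ B → mult j ν ≡ mult j μ) → zUpTo B ν ≡ zUpTo B μ
  zUpTo-cong zero    _      = refl
  zUpTo-cong (suc B) ν≗μ = cong₂ (λ x y → x * partWeight (suc B) y)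
    (zUpTo-cong B (λ j j≤B → ν≗μ j (m≤n⇒m≤1+n j≤B))) (ν≗μ (suc B) ≤-refl)

  zUpTo-stable : ∀ {B ν} d → All (_≤ B) ν → zUpTo (d + B) ν ≡ zUpTo B ν
  zUpTo-stable zero    ν≤B = refl
  zUpTo-stable {B} {ν} (suc d) ν≤B = begin
    zUpTo (d + B) ν * partWeight (suc (d + B)) (mult (suc (d + B)) ν)
      ≡⟨ cong (λ m → zUpTo (d + B) ν * partWeight (suc (d + B)) m) (mult-all< ν<top) ⟩
    zUpTo (d + B) ν * 1 ≡⟨ *-identityʳ _ ⟩
    zUpTo (d + B) ν     ≡⟨ zUpTo-stable d ν≤B ⟩
    zUpTo B ν           ∎
    where
    open ≡-Reasoning
    ν<top : All (_< suc (d + B)) ν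
    ν<top = All.map (λ x≤B → s≤s (≤-trans x≤B (m≤n+m B d))) ν≤B

  parts≤sum : ∀ ν → All (_≤ sum ν) ν
  parts≤sum []      = []
  parts≤sum (x ∷ ν) = m≤m+n x (sum ν) ∷ All.map (λ y≤ → ≤-trans y≤ (m≤n+m (sum ν) x)) (parts≤sum ν)

  z≡zUpTo : ∀ {B ν} → All (_≤ B) ν → z ν ≡ zUpTo B ν
  z≡zUpTo {B} {ν} ν≤B = begin
    z ν                     ≡⟨ z≡zUpTo-sum ν ⟩
    zUpTo (sum ν) ν         ≡⟨ zUpTo-stable B (parts≤sum ν) ⟨
    zUpTo (B + sum ν) ν     ≡⟨ cong (λ b → zUpTo b ν) (+-comm B (sum ν)) ⟩
    zUpTo (sum ν + B) ν     ≡⟨ zUpTo-stable (sum ν) ν≤B ⟩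
    zUpTo B ν               ∎
    where open ≡-Reasoning

  z-replicate-++ : ∀ k m {ν} → All (_≤ k) ν → z (replicate m (suc k) ++ ν) ≡ partWeight (suc k) m * z ν
  z-replicate-++ k m {ν} ν≤k = begin
    z (blk ++ ν)                                          ≡⟨ z≡zUpTo (++⁺ (replicate⁺ m ≤-refl) (All.map m≤n⇒m≤1+n ν≤k)) ⟩
    zUpTo k (blk ++ ν) * partWeight (suc k) (mult (suc k) (blk ++ ν))
      ≡⟨ cong₂ (λ x y → x * partWeight (suc k) y) (zUpTo-cong k below) top ⟩
    zUpTo k ν * partWeight (suc k) m                      ≡⟨ *-comm (zUpTo k ν) _ ⟩
    partWeight (suc k) m * zUpTo k ν                      ≡⟨ cong (partWeight (suc k) m *_) (*-identityʳ (zUpTo k ν)) ⟨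
    partWeight (suc k) m * (zUpTo k ν * partWeight (suc k) 0)
      ≡⟨ cong (λ y → partWeight (suc k) m * (zUpTo k ν * partWeight (suc k) y)) (mult-all< (All.map s≤s ν≤k)) ⟨
    partWeight (suc k) m * zUpTo (suc k) ν                ≡⟨ cong (partWeight (suc k) m *_) (z≡zUpTo (All.map m≤n⇒m≤1+n ν≤k)) ⟨
    partWeight (suc k) m * z ν                            ∎
    where
    open ≡-Reasoning
    blk : List ℕ
    blk = replicate m (suc k)
    below : ∀ j → j ≤ k → mult j (blk ++ ν) ≡ mult j ν
    below j j≤k = trans (mult-++ j blk ν) (cong (_+ mult j ν) (mult-replicate-≢ m (λ { refl → <-irrefl refl (s≤s j≤k) })))
    top : mult (suc k) (blk ++ ν) ≡ m
    top = trans (mult-++ (suc k) blk ν) (trans (cong₂ _+_ (mult-replicate (suc k) m) (mult-all< (All.map s≤s ν≤k))) (+-identityʳ m))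

  -- Splitting off the largest parts

  blocks : ℕ → ℕ → ℕ → List (List ℕ)
  blocks n k m =
    if m * suc k ≤ᵇ n
      then map (replicate m (suc k) ++_) (partitionsLe (n ∸ m * suc k) k)
      else []

  partitionsLe-suc : ∀ n k → partitionsLe n (suc k) ≡ concatMap (blocks n k) (upTo (suc n))
  partitionsLe-suc zero    k = refl
  partitionsLe-suc (suc n) k = refl

  partitionsLe-parts≤ : ∀ n k → All (All (_≤ k)) (partitionsLe n k)
  partitionsLe-parts≤ zero    zero    = [] ∷ []
  partitionsLe-parts≤ (suc n) zero    = []
  partitionsLe-parts≤ n       (suc k) =
    subst (All (All (_≤ suc k))) (sym (partitionsLe-suc n k))
          (concat⁺ (All-map⁺ {xs = upTo (suc n)} (All.tabulate (λ {m} _ → blocks-parts≤ m))))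
    where
    blocks-parts≤ : ∀ m → All (All (_≤ suc k)) (blocks n k m)
    blocks-parts≤ m with m * suc k ≤ᵇ n
    ... | true  = All-map⁺ (All.map (λ ν≤k → ++⁺ (replicate⁺ m ≤-refl) (All.map m≤n⇒m≤1+n ν≤k))
                                    (partitionsLe-parts≤ (n ∸ m * suc k) k))
    ... | false = []

  zSum : ℕ → ℕ → ℕ
  zSum n k = sum (map z (partitionsLe n k))

  blockTerm : ℕ → (ℕ → ℕ) → ℕ → ℕ → ℕ
  blockTerm c g n m = if m * c ≤ᵇ n then partWeight c m * g (n ∸ m * c) else 0

  sum-map-concatMap : ∀ (f : List ℕ → ℕ) (F : ℕ → List (List ℕ)) xs →
                      sum (map f (concatMap F xs)) ≡ sum (map (λ x → sum (map f (F x))) xs)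
  sum-map-concatMap f F []       = refl
  sum-map-concatMap f F (x ∷ xs) = begin
    sum (map f (F x ++ concatMap F xs))             ≡⟨ cong sum (map-++ f (F x) _) ⟩
    sum (map f (F x) ++ map f (concatMap F xs))     ≡⟨ sum-++ (map f (F x)) _ ⟩
    sum (map f (F x)) + sum (map f (concatMap F xs)) ≡⟨ cong (sum (map f (F x)) +_) (sum-map-concatMap f F xs) ⟩
    sum (map f (F x)) + sum (map (λ x → sum (map f (F x))) xs) ∎
    where open ≡-Reasoning

  zSum-prepend-block : ∀ k m {νs} → All (All (_≤ k)) νs →
                       sum (map z (map (replicate m (suc k) ++_) νs)) ≡ partWeight (suc k) m * sum (map z νs)
  zSum-prepend-block k m []              = sym (*-zeroʳ (partWeight (suc k) m))
  zSum-prepend-block k m (ν≤k ∷ νs≤k) =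
    trans (cong₂ _+_ (z-replicate-++ k m ν≤k) (zSum-prepend-block k m νs≤k)) (sym (*-distribˡ-+ (partWeight (suc k) m) _ _))

  zSum-blocks : ∀ n k → zSum n (suc k) ≡ ∑ (suc n) (blockTerm (suc k) (λ r → zSum r k) n)
  zSum-blocks n k = begin
    sum (map z (partitionsLe n (suc k)))                             ≡⟨ cong (sum ∘′ map z) (partitionsLe-suc n k) ⟩
    sum (map z (concatMap (blocks n k) (upTo (suc n))))               ≡⟨ sum-map-concatMap z (blocks n k) (upTo (suc n)) ⟩
    sum (map (λ m → sum (map z (blocks n k m))) (upTo (suc n)))       ≡⟨ cong sum (map-cong block-sum (upTo (suc n))) ⟩
    sum (map (blockTerm (suc k) (λ r → zSum r k) n) (upTo (suc n)))   ≡⟨ cong sum (map-upTo _ (suc n)) ⟩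
    ∑ (suc n) (blockTerm (suc k) (λ r → zSum r k) n)                  ∎
    where
    open ≡-Reasoning
    block-sum : ∀ m → sum (map z (blocks n k m)) ≡ blockTerm (suc k) (λ r → zSum r k) n m
    block-sum m with m * suc k ≤ᵇ n
    ... | true  = zSum-prepend-block k m (partitionsLe-parts≤ (n ∸ m * suc k) k)
    ... | false = refl

  ≤ᵇ≡true⇒≤ : ∀ {m n} → (m ≤ᵇ n) ≡ true → m ≤ n
  ≤ᵇ≡true⇒≤ eq = ≤ᵇ⇒≤ _ _ (subst T (sym eq) tt)

  blockTerm-fits : ∀ c g {n m} → m * c ≤ n → blockTerm c g n m ≡ partWeight c m * g (n ∸ m * c)
  blockTerm-fits c g {n} {m} fits with m * c ≤ᵇ n in eq
  ... | true  = refl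
  ... | false = ⊥-elim (subst T eq (≤⇒≤ᵇ fits))

  blockTerm-overflow : ∀ c g {n m} → n < m * c → blockTerm c g n m ≡ 0
  blockTerm-overflow c g {n} {m} n<mc with m * c ≤ᵇ n in eq
  ... | true  = ⊥-elim (<⇒≱ n<mc (≤ᵇ≡true⇒≤ eq))
  ... | false = refl

  blockTerm-mono-≤ : ∀ {g h} k n m → (∀ r → r < n → g r ≤ h r) →
                     blockTerm (suc k) g n (suc m) ≤ blockTerm (suc k) h n (suc m)
  blockTerm-mono-≤ k n m g≤h with suc m * suc k ≤ᵇ n in eq
  ... | true  = *-monoʳ-≤ (partWeight (suc k) (suc m)) (g≤h _ (∸-monoʳ-< z<s (≤ᵇ≡true⇒≤ eq)))
  ... | false = z≤n

  blockTerm-*ˡ : ∀ a c g n m → blockTerm c (λ r → a * g r) n m ≡ a * blockTerm c g n m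
  blockTerm-*ˡ a c g n m with m * c ≤ᵇ n
  ... | true  = x∙yz≈y∙xz (partWeight c m) a (g (n ∸ m * c))
  ... | false = sym (*-zeroʳ a)

  blockSum : ℕ → (ℕ → ℕ) → ℕ → ℕ → ℕ
  blockSum c g n L = ∑ L (λ m → blockTerm c g n (suc m))

  blockSum-mono-≤ : ∀ {g h} k n L → (∀ r → r < n → g r ≤ h r) → blockSum (suc k) g n L ≤ blockSum (suc k) h n L
  blockSum-mono-≤ k n L g≤h = ∑-mono-≤ L (λ m → blockTerm-mono-≤ k n m g≤h)

  blockSum-*ˡ : ∀ a c g n L → blockSum c (λ r → a * g r) n L ≡ a * blockSum c g n L
  blockSum-*ˡ a c g n L = trans (∑-cong L (λ m → blockTerm-*ˡ a c g n (suc m))) (∑-*ˡ a _ L)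

  blockSum-vanish : ∀ c g {n} L → n < c → blockSum c g n L ≡ 0
  blockSum-vanish c g L n<c = ∑-zero L (λ m _ → blockTerm-overflow c g {m = suc m} (≤-trans n<c (m≤m+n c (m * c))))

  zSum-suc : ∀ n k → zSum n (suc k) ≡ zSum n k + blockSum (suc k) (λ r → zSum r k) n n
  zSum-suc n k = trans (zSum-blocks n k) (cong (_+ blockSum (suc k) (λ r → zSum r k) n n) (+-identityʳ (zSum n k)))

  zSum-0 : ∀ {r} → 0 < r → zSum r 0 ≡ 0
  zSum-0 {suc r} _ = refl

  zSum-1 : ∀ n → zSum n 1 ≡ n !
  zSum-1 n = begin
    zSum n 1                   ≡⟨ zSum-blocks n 0 ⟩
    ∑ (suc n) term             ≡⟨ ∑-snoc term n ⟩
    ∑ n term + term n          ≡⟨ cong (_+ term n) (∑-zero n term-vanish) ⟩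
    term n                     ≡⟨ blockTerm-fits 1 g {n} {n} (≤-reflexive (*-identityʳ n)) ⟩
    partWeight 1 n * g (n ∸ n * 1)
      ≡⟨ cong₂ (λ x r → x * n ! * g r) (^-zeroˡ n) (trans (cong (n ∸_) (*-identityʳ n)) (n∸n≡0 n)) ⟩
    1 * n ! * 1                ≡⟨ trans (*-identityʳ _) (*-identityˡ _) ⟩
    n !                        ∎
    where
    open ≡-Reasoning
    g : ℕ → ℕ
    g r = zSum r 0
    term : ℕ → ℕ
    term = blockTerm 1 g n
    term-vanish : ∀ i → i < n → term i ≡ 0
    term-vanish i i<n with i * 1 ≤ᵇ n
    ... | false = refl
    ... | true  = trans (cong (partWeight 1 i *_) (zSum-0 (m<n⇒0<n∸m (subst (_< n) (sym (*-identityʳ i)) i<n))))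
                        (*-zeroʳ (partWeight 1 i))

  zSum-mono : ∀ n k d → zSum n k ≤ zSum n (d + k)
  zSum-mono n k zero    = ≤-refl
  zSum-mono n k (suc d) = ≤-trans (zSum-mono n k d) (≤-trans (m≤m+n _ _) (≤-reflexive (sym (zSum-suc n (d + k)))))

  zSum-stable : ∀ n d → zSum n (d + n) ≡ zSum n n
  zSum-stable n zero    = refl
  zSum-stable n (suc d) = begin
    zSum n (suc (d + n))                                      ≡⟨ zSum-suc n (d + n) ⟩
    zSum n (d + n) + blockSum (suc (d + n)) g n n
      ≡⟨ cong (zSum n (d + n) +_) (blockSum-vanish (suc (d + n)) g n (s≤s (m≤n+m n d))) ⟩
    zSum n (d + n) + 0                                        ≡⟨ +-identityʳ _ ⟩
    zSum n (d + n)                                            ≡⟨ zSum-stable n d ⟩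
    zSum n n                                                  ∎
    where
    open ≡-Reasoning
    g : ℕ → ℕ
    g r = zSum r (d + n)

  zSum≤zSum-diag : ∀ n k → zSum n k ≤ zSum n n
  zSum≤zSum-diag n k with k ≤? n
  ... | yes k≤n = subst (λ j → zSum n k ≤ zSum n j) (m∸n+n≡m k≤n) (zSum-mono n k (n ∸ k))
  ... | no  k≰n = ≤-reflexive (trans (cong (zSum n) (sym (m∸n+n≡m n≤k))) (zSum-stable n (k ∸ n)))
    where
    n≤k : n ≤ k
    n≤k = <⇒≤ (≰⇒> k≰n)

  -- The majorant Φ

  Φ : ℕ → ℕ → ℕ → ℕ
  Φ c n L = blockSum c _! n L

  !-mono-≤ : ∀ {m n} → m ≤ n → m ! ≤ n !
  !-mono-≤ {zero}  {n} z≤n = 1≤n! n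
  !-mono-≤ (s≤s m≤n)       = *-mono-≤ (s≤s m≤n) (!-mono-≤ m≤n)

  Φ-term₁ : ∀ c a → blockTerm c _! (c + a) 1 ≡ c * a !
  Φ-term₁ c a = begin
    blockTerm c _! (c + a) 1                ≡⟨ blockTerm-fits c _! {m = 1} (≤-trans (≤-reflexive (*-identityˡ c)) (m≤m+n c a)) ⟩
    c ^ 1 * 1 * (c + a ∸ 1 * c) !
      ≡⟨ cong₂ (λ x y → x * (c + a ∸ y) !) (trans (*-identityʳ _) (*-identityʳ c)) (*-identityˡ c) ⟩
    c * (c + a ∸ c) !                       ≡⟨ cong (λ r → c * r !) (m+n∸m≡n c a) ⟩
    c * a !                                 ∎
    where open ≡-Reasoning

  Φ-term-shift : ∀ c a m → blockTerm c _! (c + a) (2 + m) ≤ (c + a) * blockTerm c _! a (suc m)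
  Φ-term-shift c a m with (2 + m) * c ≤ᵇ c + a in eq
  ... | false = z≤n
  ... | true  = begin
    partWeight c (2 + m) * (c + a ∸ (c + suc m * c)) !
      ≡⟨ cong (λ r → partWeight c (2 + m) * r !) ([m+n]∸[m+o]≡n∸o c a (suc m * c)) ⟩
    c * c ^ suc m * ((2 + m) * suc m !) * (a ∸ suc m * c) !
      ≡⟨ regroup c m (c ^ suc m) (suc m !) ((a ∸ suc m * c) !) ⟩
    (2 + m) * c * (partWeight c (suc m) * (a ∸ suc m * c) !)
      ≤⟨ *-monoˡ-≤ _ fits ⟩
    (c + a) * (partWeight c (suc m) * (a ∸ suc m * c) !)
      ≡⟨ cong ((c + a) *_) (blockTerm-fits c _! {m = suc m} (+-cancelˡ-≤ c _ _ fits)) ⟨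
    (c + a) * blockTerm c _! a (suc m) ∎
    where
    open ≤-Reasoning
    fits : (2 + m) * c ≤ c + a
    fits = ≤ᵇ≡true⇒≤ eq
    regroup : ∀ c m P Q F → c * P * ((2 + m) * Q) * F ≡ (2 + m) * c * (P * Q * F)
    regroup = solve-∀

  Φ-step : ∀ c a L → Φ c (c + a) (suc L) ≤ c * a ! + (c + a) * Φ c a L
  Φ-step c a L = +-mono-≤ (≤-reflexive (Φ-term₁ c a))
    (≤-trans (∑-mono-≤ L (Φ-term-shift c a)) (≤-reflexive (∑-*ˡ (c + a) (λ m → blockTerm c _! a (suc m)) L)))

  Φ-below : ∀ c a L → a < c → Φ c (c + a) L ≤ c * a !
  Φ-below c a zero    a<c = z≤n
  Φ-below c a (suc L) a<c = begin
    Φ c (c + a) (suc L)           ≤⟨ Φ-step c a L ⟩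
    c * a ! + (c + a) * Φ c a L   ≡⟨ cong (λ x → c * a ! + (c + a) * x) (blockSum-vanish c _! L a<c) ⟩
    c * a ! + (c + a) * 0         ≡⟨ cong (c * a ! +_) (*-zeroʳ (c + a)) ⟩
    c * a ! + 0                   ≡⟨ +-identityʳ _ ⟩
    c * a !                       ∎
    where open ≤-Reasoning

  [2c+b]*b!≤5*[c+b]! : ∀ c b → 1 ≤ c → (c + (c + b)) * b ! ≤ 5 * (c + b) !
  [2c+b]*b!≤5*[c+b]! (suc e) b _ = begin
    (suc e + (suc e + b)) * b !   ≤⟨ *-monoˡ-≤ (b !) (m+n≤o⇒m≤o (suc e + (suc e + b)) (≤-reflexive (expand e b))) ⟩
    5 * (suc e + b) * b !          ≤⟨ *-monoʳ-≤ (5 * (suc e + b)) (!-mono-≤ (m≤n+m b e)) ⟩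
    5 * (suc e + b) * (e + b) !    ≡⟨ *-assoc 5 (suc e + b) _ ⟩
    5 * (suc e + b) !              ∎
    where
    open ≤-Reasoning
    expand : ∀ e b → (suc e + (suc e + b)) + (3 + 3 * e + 4 * b) ≡ 5 * (suc e + b)
    expand = solve-∀

  6*[2c+b]*b!≤5*[c+b]! : ∀ c b → 2 ≤ c → 1 ≤ b → 6 * (c + (c + b)) * b ! ≤ 5 * (c + b) !
  6*[2c+b]*b!≤5*[c+b]! .(2 + e) .(1 + f) (s≤s (s≤s {n = e} z≤n)) (s≤s {n = f} z≤n) = begin
    6 * (c + (c + b)) * b !              ≤⟨ *-monoˡ-≤ (b !) (m+n≤o⇒m≤o (6 * (c + (c + b))) (≤-reflexive (expand e f))) ⟩
    5 * (c + b) * (2 + e + f) * b !      ≤⟨ *-monoʳ-≤ (5 * (c + b) * (2 + e + f)) (!-mono-≤ (s≤s (m≤n+m f e))) ⟩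
    5 * (c + b) * (2 + e + f) * (1 + e + f) !  ≡⟨ regroup (c + b) (2 + e + f) ((1 + e + f) !) ⟩
    5 * ((c + b) * (2 + e + f) !)        ≡⟨ cong (λ t → 5 * ((c + b) * (suc t) !)) (+-suc e f) ⟨
    5 * (c + b) !                        ∎
    where
    open ≤-Reasoning
    c : ℕ
    c = 2 + e
    b : ℕ
    b = 1 + f
    expand : ∀ e f → 6 * ((2 + e) + ((2 + e) + (1 + f))) + (13 * e + 19 * f + 5 * (e + f) * (e + f))
                   ≡ 5 * ((2 + e) + (1 + f)) * (2 + e + f)
    expand = solve-∀
    regroup : ∀ x y z → 5 * x * y * z ≡ 5 * (x * (y * z))
    regroup = solve-∀

  Φ-bound : ∀ c → 2 ≤ c → ∀ a L → Φ c (c + a) L ≤ 6 * c * a !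
  Φ-bound c 2≤c = <-rec _ bound
    where
    1≤c : 1 ≤ c
    1≤c = ≤-trans (s≤s z≤n) 2≤c

    inner : ∀ b L → (∀ L → Φ c (c + b) L ≤ 6 * c * b !) → (c + (c + b)) * Φ c (c + b) L ≤ c * (5 * (c + b) !)
    inner b L rec with b <? c
    ... | yes b<c = begin
      (c + (c + b)) * Φ c (c + b) L    ≤⟨ *-monoʳ-≤ (c + (c + b)) (Φ-below c b L b<c) ⟩
      (c + (c + b)) * (c * b !)        ≡⟨ x∙yz≈y∙xz (c + (c + b)) c (b !) ⟩
      c * ((c + (c + b)) * b !)        ≤⟨ *-monoʳ-≤ c ([2c+b]*b!≤5*[c+b]! c b 1≤c) ⟩
      c * (5 * (c + b) !)              ∎
      where open ≤-Reasoning
    ... | no  b≮c = begin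
      (c + (c + b)) * Φ c (c + b) L    ≤⟨ *-monoʳ-≤ (c + (c + b)) (rec L) ⟩
      (c + (c + b)) * (6 * c * b !)    ≡⟨ regroup (c + (c + b)) c (b !) ⟩
      c * (6 * (c + (c + b)) * b !)    ≤⟨ *-monoʳ-≤ c (6*[2c+b]*b!≤5*[c+b]! c b 2≤c (≤-trans 1≤c (≮⇒≥ b≮c))) ⟩
      c * (5 * (c + b) !)              ∎
      where
      open ≤-Reasoning
      regroup : ∀ x c y → x * (6 * c * y) ≡ c * (6 * x * y)
      regroup = solve-∀

    bound : ∀ a → (∀ {b} → b < a → ∀ L → Φ c (c + b) L ≤ 6 * c * b !) → ∀ L → Φ c (c + a) L ≤ 6 * c * a !
    bound a rec L with a <? c
    ... | yes a<c = ≤-trans (Φ-below c a L a<c) (*-monoˡ-≤ (a !) (m≤n*m c 6))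
    ... | no  a≮c = subst (λ a → Φ c (c + a) L ≤ 6 * c * a !) (m+[n∸m]≡n c≤a) (unrolled L)
      where
      c≤a : c ≤ a
      c≤a = ≮⇒≥ a≮c
      b : ℕ
      b = a ∸ c
      unrolled : ∀ L → Φ c (c + (c + b)) L ≤ 6 * c * (c + b) !
      unrolled zero    = z≤n
      unrolled (suc L) = begin
        Φ c (c + (c + b)) (suc L)                      ≤⟨ Φ-step c (c + b) L ⟩
        c * (c + b) ! + (c + (c + b)) * Φ c (c + b) L  ≤⟨ +-monoʳ-≤ (c * (c + b) !) (inner b L (rec (∸-monoʳ-< 1≤c c≤a))) ⟩
        c * (c + b) ! + c * (5 * (c + b) !)            ≡⟨ collect c ((c + b) !) ⟩
        6 * c * (c + b) !                              ∎
        where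
        open ≤-Reasoning
        collect : ∀ c x → c * x + c * (5 * x) ≡ 6 * c * x
        collect = solve-∀

  -- An upper bound for ∑_{j<N} j!, by !+δ≤δ-suc.
  δ : ℕ → ℕ
  δ zero          = 0
  δ (suc zero)    = 1
  δ (suc (suc N)) = 2 * suc N !

  !+δ≤δ-suc : ∀ N → N ! + δ N ≤ δ (suc N)
  !+δ≤δ-suc zero          = ≤-refl
  !+δ≤δ-suc (suc zero)    = ≤-refl
  !+δ≤δ-suc (suc (suc N)) = m+n≤o⇒m≤o _ (≤-reflexive (expand N (suc N !)))
    where
    expand : ∀ N F → ((2 + N) * F + 2 * F) + N * F ≡ 2 * ((2 + N) * F)
    expand = solve-∀

  δ-suc≤ : ∀ a → δ (suc a) ≤ 2 * a !
  δ-suc≤ zero    = s≤s z≤n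
  δ-suc≤ (suc a) = ≤-refl

  Φ-tail : ∀ c → 2 ≤ c → ∀ n K → ∑ K (λ j → Φ (c + j) n n) ≤ 6 * n * δ (suc n ∸ c)
  Φ-tail c 2≤c n zero    = z≤n
  Φ-tail c 2≤c n (suc K) = begin
    ∑ (suc K) (λ j → Φ (c + j) n n)
      ≡⟨ cong₂ _+_ (cong (λ x → Φ x n n) (+-identityʳ c)) (∑-cong K (λ j → cong (λ x → Φ x n n) (+-suc c j))) ⟩
    Φ c n n + ∑ K (λ j → Φ (suc c + j) n n)    ≤⟨ +-monoʳ-≤ (Φ c n n) (Φ-tail (suc c) (m≤n⇒m≤1+n 2≤c) n K) ⟩
    Φ c n n + 6 * n * δ (n ∸ c)                ≤⟨ head+tail ⟩
    6 * n * δ (suc n ∸ c)                      ∎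
    where
    open ≤-Reasoning
    head+tail : Φ c n n + 6 * n * δ (n ∸ c) ≤ 6 * n * δ (suc n ∸ c)
    head+tail with c ≤? n
    ... | yes c≤n = begin
      Φ c n n + 6 * n * δ (n ∸ c)              ≤⟨ +-monoˡ-≤ _ head ⟩
      6 * n * (n ∸ c) ! + 6 * n * δ (n ∸ c)    ≡⟨ *-distribˡ-+ (6 * n) _ _ ⟨
      6 * n * ((n ∸ c) ! + δ (n ∸ c))          ≤⟨ *-monoʳ-≤ (6 * n) (!+δ≤δ-suc (n ∸ c)) ⟩
      6 * n * δ (suc (n ∸ c))                  ≡⟨ cong (λ x → 6 * n * δ x) (+-∸-assoc 1 c≤n) ⟨
      6 * n * δ (suc n ∸ c)                    ∎
      where
      head : Φ c n n ≤ 6 * n * (n ∸ c) !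
      head = ≤-trans (subst (λ x → Φ c x n ≤ 6 * c * (n ∸ c) !) (m+[n∸m]≡n c≤n) (Φ-bound c 2≤c (n ∸ c) n))
                     (*-monoˡ-≤ ((n ∸ c) !) (*-monoʳ-≤ 6 c≤n))
    ... | no  c≰n = ≤-trans (≤-reflexive vanish) z≤n
      where
      n<c : n < c
      n<c = ≰⇒> c≰n
      vanish : Φ c n n + 6 * n * δ (n ∸ c) ≡ 0
      vanish = cong₂ _+_ (blockSum-vanish c _! n n<c)
                         (trans (cong (λ x → 6 * n * δ x) (m≤n⇒m∸n≡0 (<⇒≤ n<c))) (*-zeroʳ (6 * n)))

  -- The bound Z(n,k) ≤ 2 n!

  ZSumBoundBelow : ℕ → Set
  ZSumBoundBelow n = ∀ {r} → r < n → ∀ k → zSum r k ≤ 2 * r !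

  zSum-upper : ∀ {n} → ZSumBoundBelow n → ∀ K → zSum n (2 + K) ≤ n ! + Φ 2 n n + 2 * ∑ K (λ j → Φ (3 + j) n n)
  zSum-upper {n} below zero = begin
    zSum n 2                                        ≡⟨ zSum-suc n 1 ⟩
    zSum n 1 + blockSum 2 (λ r → zSum r 1) n n
      ≤⟨ +-mono-≤ (≤-reflexive (zSum-1 n)) (blockSum-mono-≤ 1 n n (λ r _ → ≤-reflexive (zSum-1 r))) ⟩
    n ! + Φ 2 n n                                   ≡⟨ +-identityʳ _ ⟨
    n ! + Φ 2 n n + 2 * 0                           ∎
    where open ≤-Reasoning
  zSum-upper {n} below (suc K) = begin
    zSum n (3 + K)                                                        ≡⟨ zSum-suc n (2 + K) ⟩
    zSum n (2 + K) + blockSum (3 + K) (λ r → zSum r (2 + K)) n n          ≤⟨ +-mono-≤ (zSum-upper below K) blocks≤ ⟩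
    n ! + Φ 2 n n + 2 * ∑ K tail + 2 * tail K                             ≡⟨ regroup (n ! + Φ 2 n n) (∑ K tail) (tail K) ⟩
    n ! + Φ 2 n n + 2 * (∑ K tail + tail K)                               ≡⟨ cong (λ x → n ! + Φ 2 n n + 2 * x) (∑-snoc tail K) ⟨
    n ! + Φ 2 n n + 2 * ∑ (suc K) tail                                    ∎
    where
    open ≤-Reasoning
    tail : ℕ → ℕ
    tail j = Φ (3 + j) n n
    blocks≤ : blockSum (3 + K) (λ r → zSum r (2 + K)) n n ≤ 2 * tail K
    blocks≤ = ≤-trans (blockSum-mono-≤ (2 + K) n n (λ r r<n → below r<n (2 + K))) (≤-reflexive (blockSum-*ˡ 2 (3 + K) _! n n))
    regroup : ∀ x y z → x + 2 * y + 2 * z ≡ x + 2 * (y + z)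
    regroup = solve-∀

  excess : ℕ → ℕ
  excess a = 2 * (2 + a) ! + 36 * (1 + a) ! + 36 * (4 + a) * a !

  zSum-diag-upper : ∀ a → ZSumBoundBelow (4 + a) → zSum (4 + a) (4 + a) ≤ (4 + a) ! + excess a
  zSum-diag-upper a below = begin
    zSum n n                                                  ≤⟨ zSum-upper below (2 + a) ⟩
    n ! + Φ 2 n n + 2 * (Φ 3 n n + ∑ (1 + a) (λ j → Φ (4 + j) n n))
      ≤⟨ +-mono-≤ (+-monoʳ-≤ (n !) Φ₂) (*-monoʳ-≤ 2 (+-mono-≤ Φ₃ Φ≥₄)) ⟩
    n ! + (2 * (2 + a) ! + n * (12 * a !)) + 2 * (18 * (1 + a) ! + 6 * n * (2 * a !))
      ≡⟨ regroup (n !) ((2 + a) !) ((1 + a) !) (a !) n ⟩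
    n ! + excess a                                            ∎
    where
    open ≤-Reasoning
    n : ℕ
    n = 4 + a
    Φ₂ : Φ 2 n n ≤ 2 * (2 + a) ! + n * (12 * a !)
    Φ₂ = ≤-trans (Φ-step 2 (2 + a) (3 + a)) (+-monoʳ-≤ (2 * (2 + a) !) (*-monoʳ-≤ n (Φ-bound 2 ≤-refl a (3 + a))))
    Φ₃ : Φ 3 n n ≤ 18 * (1 + a) !
    Φ₃ = Φ-bound 3 (s≤s (s≤s z≤n)) (1 + a) n
    Φ≥₄ : ∑ (1 + a) (λ j → Φ (4 + j) n n) ≤ 6 * n * (2 * a !)
    Φ≥₄ = ≤-trans (Φ-tail 4 (s≤s (s≤s z≤n)) n (1 + a)) (*-monoʳ-≤ (6 * n) (δ-suc≤ a))
    regroup : ∀ N X Y Z n → N + (2 * X + n * (12 * Z)) + 2 * (18 * Y + 6 * n * (2 * Z)) ≡ N + (2 * X + 36 * Y + 36 * n * Z)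
    regroup = solve-∀

  excess≤! : ∀ b → excess (2 + b) ≤ (6 + b) !
  excess≤! b = m+n≤o⇒m≤o _ (≤-reflexive (expand b ((2 + b) !)))
    where
    expand : ∀ b F → (2 * ((4 + b) * ((3 + b) * F)) + 36 * ((3 + b) * F) + 36 * (6 + b) * F)
                     + (b * b * b * b + 18 * b * b * b + 117 * b * b + 256 * b + 12) * F
                   ≡ (6 + b) * ((5 + b) * ((4 + b) * ((3 + b) * F)))
    expand = solve-∀

  zSum≤2*! : ∀ n k → zSum n k ≤ 2 * n !
  zSum≤2*! = <-rec _ bound
    where
    diag : ∀ n → ZSumBoundBelow n → zSum n n ≤ 2 * n !
    -- excess≤! needs n ≥ 6; the cases n ≤ 5 are checked by evaluation.
    diag 0 _ = ≤ᵇ⇒≤ _ _ tt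
    diag 1 _ = ≤ᵇ⇒≤ _ _ tt
    diag 2 _ = ≤ᵇ⇒≤ _ _ tt
    diag 3 _ = ≤ᵇ⇒≤ _ _ tt
    diag 4 _ = ≤ᵇ⇒≤ _ _ tt
    diag 5 _ = ≤ᵇ⇒≤ _ _ tt
    diag (suc (suc (suc (suc (suc (suc b)))))) below = begin
      zSum (6 + b) (6 + b)          ≤⟨ zSum-diag-upper (2 + b) below ⟩
      (6 + b) ! + excess (2 + b)    ≤⟨ +-monoʳ-≤ ((6 + b) !) (excess≤! b) ⟩
      (6 + b) ! + (6 + b) !         ≡⟨ cong ((6 + b) ! +_) (+-identityʳ ((6 + b) !)) ⟨
      2 * (6 + b) !                 ∎
      where open ≤-Reasoning
    bound : ∀ n → ZSumBoundBelow n → ∀ k → zSum n k ≤ 2 * n !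
    bound n below k = ≤-trans (zSum≤zSum-diag n k) (diag n below)

  -- Second-order asymptotics of Z(n,n)

  zSum-lower : ∀ b → (2 + b) ! + 2 * b ! ≤ zSum (2 + b) (2 + b)
  zSum-lower b = begin
    n ! + 2 * b !                                 ≡⟨ cong₂ (λ x y → x + 2 * y) (zSum-1 n) (zSum-1 b) ⟨
    zSum n 1 + 2 * zSum b 1                       ≤⟨ +-monoʳ-≤ (zSum n 1) (m≤m+n _ _) ⟩
    zSum n 1 + blockSum 2 (λ r → zSum r 1) n n    ≡⟨ zSum-suc n 1 ⟨
    zSum n 2                                      ≤⟨ zSum-mono n 2 b ⟩
    zSum n (b + 2)                                ≡⟨ cong (zSum n) (+-comm b 2) ⟩
    zSum n n                                      ∎
    where
    open ≤-Reasoning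
    n : ℕ
    n = 2 + b

  zSum-scaled-lower : ∀ {n} → 2 ≤ n → n ! * n ^ 2 + 2 * n ! ≤ zSum n n * n ^ 2
  zSum-scaled-lower (s≤s (s≤s {n = b} z≤n)) = begin
    n ! * n ^ 2 + 2 * n !                  ≤⟨ +-monoʳ-≤ (n ! * n ^ 2) (m+n≤o⇒m≤o _ (≤-reflexive (expand b (b !)))) ⟩
    n ! * n ^ 2 + 2 * b ! * n ^ 2          ≡⟨ *-distribʳ-+ (n ^ 2) (n !) (2 * b !) ⟨
    (n ! + 2 * b !) * n ^ 2                ≤⟨ *-monoˡ-≤ (n ^ 2) (zSum-lower b) ⟩
    zSum n n * n ^ 2                       ∎
    where
    open ≤-Reasoning
    n : ℕ
    n = 2 + b
    expand : ∀ b F → 2 * ((2 + b) * ((1 + b) * F)) + 2 * (2 + b) * F ≡ 2 * F * ((2 + b) * ((2 + b) * 1))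
    expand = solve-∀

  q*quadratic≤cubic : ∀ q a → 100 * q ≤ a → q * (74 * a * a + 474 * a + 724) ≤ (3 + a) * ((2 + a) * (1 + a))
  q*quadratic≤cubic zero    a _       = z≤n
  q*quadratic≤cubic (suc q) a 100q≤a = begin
    suc q * (74 * a * a + 474 * a + 724)    ≤⟨ *-monoʳ-≤ (suc q) quadratic≤ ⟩
    suc q * (100 * a * a)                   ≡⟨ regroup (suc q) a ⟩
    100 * suc q * (a * a)                   ≤⟨ *-monoˡ-≤ (a * a) 100q≤a ⟩
    a * (a * a)                             ≤⟨ *-mono-≤ (m≤n+m a 3) (*-mono-≤ (m≤n+m a 2) (m≤n+m a 1)) ⟩
    (3 + a) * ((2 + a) * (1 + a))           ∎
    where
    open ≤-Reasoning
    100≤a : 100 ≤ a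
    100≤a = ≤-trans (*-monoʳ-≤ 100 (s≤s z≤n)) 100q≤a
    expand : ∀ s → (74 * (100 + s) * (100 + s) + 474 * (100 + s) + 724) + (26 * s * s + 4726 * s + 211876) ≡ 100 * (100 + s) * (100 + s)
    expand = solve-∀
    quadratic≤ : 74 * a * a + 474 * a + 724 ≤ 100 * a * a
    quadratic≤ = subst (λ a → 74 * a * a + 474 * a + 724 ≤ 100 * a * a) (m+[n∸m]≡n 100≤a)
                       (m+n≤o⇒m≤o _ (≤-reflexive (expand (a ∸ 100))))
    regroup : ∀ q a → q * (100 * a * a) ≡ 100 * q * (a * a)
    regroup = solve-∀

  excess-scaled : ∀ a → excess a * (4 + a) ^ 2 ≡ 2 * (4 + a) ! + (4 + a) * a ! * (74 * a * a + 474 * a + 724)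
  excess-scaled a = expand a (a !)
    where
    expand : ∀ a F → (2 * ((2 + a) * ((1 + a) * F)) + 36 * ((1 + a) * F) + 36 * (4 + a) * F) * ((4 + a) * ((4 + a) * 1))
                   ≡ 2 * ((4 + a) * ((3 + a) * ((2 + a) * ((1 + a) * F)))) + (4 + a) * F * (74 * a * a + 474 * a + 724)
    expand = solve-∀

  zSum-scaled-upper : ∀ q {n} → 4 + 100 * q ≤ n → q * (zSum n n * n ^ 2) ≤ q * (n ! * n ^ 2 + 2 * n !) + n !
  zSum-scaled-upper q (s≤s (s≤s (s≤s (s≤s {n = a} 100q≤a)))) = begin
    q * (zSum n n * n ^ 2)                            ≤⟨ *-monoʳ-≤ q (*-monoˡ-≤ (n ^ 2) (zSum-diag-upper a (λ {r} _ → zSum≤2*! r))) ⟩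
    q * ((n ! + excess a) * n ^ 2)                    ≡⟨ cong (q *_) (*-distribʳ-+ (n ^ 2) (n !) (excess a)) ⟩
    q * (n ! * n ^ 2 + excess a * n ^ 2)              ≡⟨ cong (λ x → q * (n ! * n ^ 2 + x)) (excess-scaled a) ⟩
    q * (n ! * n ^ 2 + (2 * n ! + n * a ! * P))       ≡⟨ regroup q (n ! * n ^ 2) (2 * n !) (n * a !) P ⟩
    q * (n ! * n ^ 2 + 2 * n !) + n * a ! * (q * P)   ≤⟨ +-monoʳ-≤ _ (*-monoʳ-≤ (n * a !) (q*quadratic≤cubic q a 100q≤a)) ⟩
    q * (n ! * n ^ 2 + 2 * n !) + n * a ! * ((3 + a) * ((2 + a) * (1 + a)))
      ≡⟨ cong (q * (n ! * n ^ 2 + 2 * n !) +_) (factorial a (a !)) ⟩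
    q * (n ! * n ^ 2 + 2 * n !) + n !                 ∎
    where
    open ≤-Reasoning
    n : ℕ
    n = 4 + a
    P : ℕ
    P = 74 * a * a + 474 * a + 724
    regroup : ∀ q x y m P → q * (x + (y + m * P)) ≡ q * (x + y) + m * (q * P)
    regroup = solve-∀
    factorial : ∀ a F → (4 + a) * F * ((3 + a) * ((2 + a) * (1 + a))) ≡ (4 + a) * ((3 + a) * ((2 + a) * ((1 + a) * F)))
    factorial = solve-∀

  ∸-scaled≤ : ∀ q u v f → q * u ≤ q * v + f → (u ∸ v) * q ≤ f
  ∸-scaled≤ q u v f qu≤qv+f = begin
    (u ∸ v) * q     ≡⟨ *-distribʳ-∸ q u v ⟩
    u * q ∸ v * q   ≤⟨ m≤n+o⇒m∸n≤o (u * q) (v * q) (subst₂ (λ x y → x ≤ y + f) (*-comm q u) (*-comm q v) qu≤qv+f) ⟩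
    f               ∎
    where open ≤-Reasoning

module RationalEmbedding where

  open import Defs
  open import Data.Nat as ℕ using (ℕ; suc)
  import Data.Nat.Properties as ℕ
  open import Data.Integer as ℤ using (+_)
  import Data.Integer.Properties as ℤ
  open import Data.Rational using (ℚ; mkℚ; _≤_; _*_; _-_; _+_; ∣_∣)
  open import Data.Rational.Properties using (↥p/↧p≡p; toℚᵘ-injective; toℚᵘ-homo-+; toℚᵘ-homo-*; toℚᵘ-cancel-≤)
  open import Data.Rational.Solver using (module +-*-Solver)
  import Data.Rational.Unnormalised as ℚᵘ
  import Data.Rational.Unnormalised.Properties as ℚᵘ
  import Data.Nat.Coprimality as C
  open import Relation.Binary.PropositionalEquality

  -- ℕtoℚ k = + k / 1 normalises through a gcd and so only computes on literals; ι is its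
  -- normal form.
  ι : ℕ → ℚ
  ι k = mkℚ (+ k) 0 (C.sym (C.1-coprimeTo k))

  ℕtoℚ≡ι : ∀ k → ℕtoℚ k ≡ ι k
  ℕtoℚ≡ι k = ↥p/↧p≡p (ι k)

  ℕtoℚ-+ : ∀ a b → ℕtoℚ (a ℕ.+ b) ≡ ℕtoℚ a + ℕtoℚ b
  ℕtoℚ-+ a b rewrite ℕtoℚ≡ι (a ℕ.+ b) | ℕtoℚ≡ι a | ℕtoℚ≡ι b =
    toℚᵘ-injective (ℚᵘ.≃-trans (ℚᵘ.*≡* numerators) (ℚᵘ.≃-sym (toℚᵘ-homo-+ (ι a) (ι b))))
    where
    numerators : + (a ℕ.+ b) ℤ.* + 1 ≡ (+ a ℤ.* + 1 ℤ.+ + b ℤ.* + 1) ℤ.* + 1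
    numerators = cong (ℤ._* + 1) (trans (ℤ.pos-+ a b) (sym (cong₂ ℤ._+_ (ℤ.*-identityʳ (+ a)) (ℤ.*-identityʳ (+ b)))))

  ℕtoℚ-* : ∀ a b → ℕtoℚ (a ℕ.* b) ≡ ℕtoℚ a * ℕtoℚ b
  ℕtoℚ-* a b rewrite ℕtoℚ≡ι (a ℕ.* b) | ℕtoℚ≡ι a | ℕtoℚ≡ι b =
    toℚᵘ-injective (ℚᵘ.≃-trans (ℚᵘ.*≡* (cong (ℤ._* + 1) (ℤ.pos-* a b))) (ℚᵘ.≃-sym (toℚᵘ-homo-* (ι a) (ι b))))

  open +-*-Solver

  ℕtoℚ-∸ : ∀ {a b} → b ℕ.≤ a → ℕtoℚ a - ℕtoℚ b ≡ ℕtoℚ (a ℕ.∸ b)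
  ℕtoℚ-∸ {a} {b} b≤a = begin
    ℕtoℚ a - ℕtoℚ b                      ≡⟨ cong (λ x → ℕtoℚ x - ℕtoℚ b) (ℕ.m∸n+n≡m b≤a) ⟨
    ℕtoℚ (a ℕ.∸ b ℕ.+ b) - ℕtoℚ b        ≡⟨ cong (_- ℕtoℚ b) (ℕtoℚ-+ (a ℕ.∸ b) b) ⟩
    ℕtoℚ (a ℕ.∸ b) + ℕtoℚ b - ℕtoℚ b     ≡⟨ solve 2 (λ x y → x :+ y :- y := x) refl (ℕtoℚ (a ℕ.∸ b)) (ℕtoℚ b) ⟩
    ℕtoℚ (a ℕ.∸ b)                       ∎
    where open ≡-Reasoning

  ∣ℕtoℚ∣ : ∀ a → ∣ ℕtoℚ a ∣ ≡ ℕtoℚ a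
  ∣ℕtoℚ∣ a rewrite ℕtoℚ≡ι a = refl

  scaled-difference : ∀ t f s →
    (ℕtoℚ t - ℕtoℚ f) * ℕtoℚ s - ℕtoℚ 2 * ℕtoℚ f ≡ ℕtoℚ (t ℕ.* s) - ℕtoℚ (f ℕ.* s ℕ.+ 2 ℕ.* f)
  scaled-difference t f s rewrite ℕtoℚ-* t s | ℕtoℚ-+ (f ℕ.* s) (2 ℕ.* f) | ℕtoℚ-* f s | ℕtoℚ-* 2 f =
    solve 4 (λ t f s two → (t :- f) :* s :- two :* f := t :* s :- (f :* s :+ two :* f))
            refl (ℕtoℚ t) (ℕtoℚ f) (ℕtoℚ s) (ℕtoℚ 2)

  ∣ℕtoℚ-ℕtoℚ∣ : ∀ {u v} → v ℕ.≤ u → ∣ ℕtoℚ u - ℕtoℚ v ∣ ≡ ℕtoℚ (u ℕ.∸ v)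
  ∣ℕtoℚ-ℕtoℚ∣ {u} {v} v≤u = trans (cong ∣_∣ (ℕtoℚ-∸ v≤u)) (∣ℕtoℚ∣ (u ℕ.∸ v))

  ℕtoℚ≤mkℚ*ℕtoℚ : ∀ w p q-1 .(c : C.Coprime p (suc q-1)) f →
                  w ℕ.* suc q-1 ℕ.≤ p ℕ.* f → ℕtoℚ w ≤ mkℚ (+ p) q-1 c * ℕtoℚ f
  ℕtoℚ≤mkℚ*ℕtoℚ w p q-1 c f wq≤pf rewrite ℕtoℚ≡ι w | ℕtoℚ≡ι f =
    toℚᵘ-cancel-≤ (ℚᵘ.≤-respʳ-≃ (ℚᵘ.≃-sym (toℚᵘ-homo-* (mkℚ (+ p) q-1 c) (ι f))) (ℚᵘ.*≤* cross))
    where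
    cross : + w ℤ.* + suc (q-1 ℕ.* 1) ℤ.≤ (+ p ℤ.* + f) ℤ.* + 1
    cross = subst₂ ℤ._≤_ (trans (ℤ.pos-* w (suc q-1)) (cong (λ d → + w ℤ.* + suc d) (sym (ℕ.*-identityʳ q-1))))
                         (trans (ℤ.pos-* p f) (sym (ℤ.*-identityʳ (+ p ℤ.* + f))))
                         (ℤ.+≤+ wq≤pf)

open import Defs
open import Data.Nat using (ℕ; zero; suc; _≥_; _^_; _!; _+_; _∸_; s≤s)
import Data.Nat as ℕ
open import Data.Nat.Properties using (≤-trans; m≤n*m)
open import Data.Integer using (+_; -[1+_]; +<+)
open import Data.Product using (∃-syntax; _,_)
open import Data.Rational using (ℚ; mkℚ; _<_; _≤_; _*_; _-_; ∣_∣; 0ℚ; *<*)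
open import Data.Rational.Properties using (module ≤-Reasoning)
open import Relation.Binary.PropositionalEquality using (cong)
open PartitionSums using (zSum; zSum-scaled-lower; zSum-scaled-upper; ∸-scaled≤)
open RationalEmbedding using (scaled-difference; ∣ℕtoℚ-ℕtoℚ∣; ℕtoℚ≤mkℚ*ℕtoℚ)

lemma3p3 : ∀ (ε : ℚ) → 0ℚ < ε → ∃[ N ] ∀ (n : ℕ) → n ≥ N → ∣ X n * ℕtoℚ (n ^ 2) - ℕtoℚ 2 * ℕtoℚ (n !) ∣ ≤ ε * ℕtoℚ (n !)
lemma3p3 (mkℚ (+ zero) _ _)     (*<* (+<+ ()))
lemma3p3 (mkℚ -[1+ _ ] _ _)     (*<* ())
lemma3p3 ε@(mkℚ (+ suc p) q-1 c) _ = 4 + 100 ℕ.* q , bound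
  where
  q : ℕ
  q = suc q-1
  bound : ∀ n → n ≥ 4 + 100 ℕ.* q → ∣ X n * ℕtoℚ (n ^ 2) - ℕtoℚ 2 * ℕtoℚ (n !) ∣ ≤ ε * ℕtoℚ (n !)
  bound n n≥N = begin
    ∣ X n * ℕtoℚ (n ^ 2) - ℕtoℚ 2 * ℕtoℚ (n !) ∣   ≡⟨ cong ∣_∣ (scaled-difference (zSum n n) (n !) (n ^ 2)) ⟩
    ∣ ℕtoℚ u - ℕtoℚ v ∣                            ≡⟨ ∣ℕtoℚ-ℕtoℚ∣ (zSum-scaled-lower 2≤n) ⟩
    ℕtoℚ (u ∸ v)                                    ≤⟨ ℕtoℚ≤mkℚ*ℕtoℚ (u ∸ v) (suc p) q-1 c (n !) error≤ ⟩
    ε * ℕtoℚ (n !)                                  ∎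
    where
    open ≤-Reasoning
    u : ℕ
    u = zSum n n ℕ.* n ^ 2
    v : ℕ
    v = n ! ℕ.* n ^ 2 + 2 ℕ.* n !
    2≤n : 2 ℕ.≤ n
    2≤n = ≤-trans (s≤s (s≤s ℕ.z≤n)) n≥N
    error≤ : (u ∸ v) ℕ.* q ℕ.≤ suc p ℕ.* n !
    error≤ = ≤-trans (∸-scaled≤ q u v (n !) (zSum-scaled-upper q n≥N)) (m≤n*m (n !) (suc p))
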